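{- Let $\delta\in\{\mathsf{none},\mathsf{down},\mathsf{up},\mathsf{updown}\}^n$. If $T,T'\in\mathcal{PT}_n(\delta)$ satisfy $T<T'$ in the $\delta$-permutree rotation lattice, then $\vec{c}(T)<_{lex}\vec{c}(T')$. Moreover, every edge of the cubical realization $\mathcal{C}_\delta$ has direction $\mathbf{e}_i$ for some $i\in[n-1]$ (a standard basis vector of $\mathbb{R}^{n-1}$).
   Context: $[n]=\{1,\dots,n\}$. A permutree on $n$ vertices is a directed (unrooted, planar) tree $T$ with vertex set $\{v_1,\dots,v_n\}$, edges oriented from child to parent, such that each vertex $v_i$ has exactly one or two parents and exactly one or two children, and: if $v_i$ has two parents then every vertex $v_j$ in its left ancestor subtree has $j<i$ and every $v_k$ in its right ancestor subtree has $k>i$; if $v_i$ has two children then every $v_j$ in its left descendant subtree $LD_i$ has $j<i$ and every $v_k$ in its right descendant subtree $RD_i$ has $k>i$ (ancestor/descendant subtrees are the components of $T\setminus v_i$ containing the respective parents/children; if $v_i$ has one child, $D_i$ denotes its unique descendant subtree). The decoration $\delta(T)_i$ is $\mathsf{none}$, $\mathsf{down}$, $\mathsf{up}$, $\mathsf{updown}$ according as $v_i$ has (one parent, one child), (one parent, two children), (two parents, one child), (two parents, two children); $\mathcal{PT}_n(\delta)$ is the set of permutrees with decoration $\delta$ (convention $\delta_1=\delta_n=\mathsf{none}$). We write $i\to j$ if $v_i$ is a descendant of $v_j$. The rotation order (Pilaud–Pons) is the transitive closure of increasing edge rotations: for an edge $i\to j$ with $i<j$, the $ij$-edge rotation replaces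 it by an edge $j\to i$ (rearranging the adjacent subtrees) while preserving all other edge cuts; $T\lessdot T'$ denotes a cover relation. The cubic set of $T$ is $C(T)=\{(i,j): i<j,\ v_j\in D_i\text{ if }\delta_i\in\{\mathsf{none},\mathsf{up}\};\ v_j\in RD_i\text{ if }\delta_i\in\{\mathsf{down},\mathsf{updown}\}\}$, with components $C(T)_i=\{j:(i,j)\in C(T)\}$, and the cubic vector is $\vec{c}(T)=(c_1,\dots,c_{n-1})$ with $c_i=|C(T)_i|$. The cubical realization $\mathcal{C}_\delta$ is the convex hull of all cubic vectors $\vec{c}(T)$, $T\in\mathcal{PT}_n(\delta)$, together with an edge between $\vec{c}(T)$ and $\vec{c}(T')$ whenever $T\lessdot T'$. $<_{lex}$ is the lexicographic order. -}

module Defs where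

open import Data.Nat using (ℕ; zero; suc; _≤_)
open import Data.Bool using (Bool; true; false; _∧_; _∨_; not)
open import Data.Fin using (Fin; toℕ; inject₁; fromℕ; _<_) renaming (zero to fzero)
import Data.Fin as F
open import Data.List using (List; length; filterᵇ)
open import Data.Bool.ListAction using (any)
open import Data.List using () renaming (allFin to allFinL)
open import Data.Vec using (Vec; tabulate)
open import Data.Product using (Σ; ∃; ∃-syntax; _×_; _,_; proj₁)
open import Data.Sum using (_⊎_)
open import Data.Empty using (⊥)
open import Relation.Nullary using (¬_)
open import Relation.Nullary.Decidable using (⌊_⌋)
open import Relation.Binary.PropositionalEquality using (_≡_; _≢_)
open import Relation.Binary.Construct.Closure.Transitive using (TransClosure)
open import Data.Vec.Relation.Binary.Lex.Strict using (Lex-<)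

data Decoration : Set where
  none down up updown : Decoration

parentSlots : Decoration → ℕ
parentSlots none   = 1
parentSlots down   = 1
parentSlots up     = 2
parentSlots updown = 2

childSlots : Decoration → ℕ
childSlots none   = 1
childSlots down   = 2
childSlots up     = 1
childSlots updown = 2

-- Directed graphs on the vertex set {v_1,…,v_n}, vertex v_{i+1} ↔ (i : Fin n).
-- G a b ≡ true  iff  there is an edge  a → b  (v_a is a child of v_b).

Graph : ℕ → Set
Graph n = Fin n → Fin n → Bool

_==_ : ∀ {n} → Fin n → Fin n → Bool
a == b = ⌊ a F.≟ b ⌋

_<ᵇ_ : ∀ {n} → Fin n → Fin n → Bool
a <ᵇ b = ⌊ a F.<? b ⌋

adj : ∀ {n} → Graph n → Fin n → Fin n → Bool
adj G a b = G a b ∨ G b a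

reach : ∀ {n} → (Fin n → Fin n → Bool) → ℕ → Fin n → Fin n → Bool
reach ok zero    u w = u == w
reach ok (suc k) u w = reach ok k u w ∨ any (λ v → reach ok k u v ∧ ok v w) (allFinL _)

-- path-connectedness (walks of length ≤ n suffice)
connectedIn : ∀ {n} → (Fin n → Fin n → Bool) → Fin n → Fin n → Bool
connectedIn {n} ok u w = reach ok n u w

adjMinusEdge : ∀ {n} → Graph n → Fin n → Fin n → Fin n → Fin n → Bool
adjMinusEdge G a b x y =
  adj G x y ∧ not ((x == a ∧ y == b) ∨ (x == b ∧ y == a))

adjMinusVertex : ∀ {n} → Graph n → Fin n → Fin n → Fin n → Bool
adjMinusVertex G v x y = adj G x y ∧ not (x == v) ∧ not (y == v)

-- The underlying graph is a tree: no loops, no 2-cycles, connected,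
-- and acyclic (every edge is a bridge).
IsTree : ∀ {n} → Graph n → Set
IsTree {n} G =
  (∀ a → G a a ≡ false) ×
  (∀ a b → G a b ≡ true → G b a ≡ false) ×
  (∀ a b → connectedIn (adj G) a b ≡ true) ×
  (∀ a b → G a b ≡ true → connectedIn (adjMinusEdge G a b) a b ≡ false)

comp : ∀ {n} → Graph n → Fin n → Fin n → Fin n → Bool
comp G v u w = connectedIn (adjMinusVertex G v) u w

parents : ∀ {n} → Graph n → Fin n → List (Fin n)
parents G v = filterᵇ (λ p → G v p) (allFinL _)

children : ∀ {n} → Graph n → Fin n → List (Fin n)
children G v = filterᵇ (λ c → G c v) (allFinL _)

AllBelow AllAbove : ∀ {n} → Graph n → Fin n → Fin n → Set
AllBelow G v u = ∀ w → comp G v u w ≡ true → w < v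
AllAbove G v u = ∀ w → comp G v u w ≡ true → v < w

twoParents : Decoration → Bool
twoParents up     = true
twoParents updown = true
twoParents _      = false

twoChildren : Decoration → Bool
twoChildren down   = true
twoChildren updown = true
twoChildren _      = false

-- Missing parents/children of a vertex are dangling edges (blossoms), so
-- each vertex has at most parentSlots / childSlots neighbouring parents /
-- children.  The planar left/right position of the neighbours of a vertex
-- with two parents (resp. children) is the one forced by the labels: the
-- left ancestor (resp. descendant) subtree is the one with labels < i and
-- the right one the one with labels > i.
record IsPermutree {n} (δ : Fin n → Decoration) (G : Graph n) : Set where
  field
    tree         : IsTree G
    parentCount  : ∀ v → length (parents G v) ≤ parentSlots (δ v)
    childCount   : ∀ v → length (children G v) ≤ childSlots (δ v)
    upSides      : ∀ v → twoParents (δ v) ≡ true → ∀ p → G v p ≡ true →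
                   AllBelow G v p ⊎ AllAbove G v p
    upDistinct   : ∀ v → twoParents (δ v) ≡ true → ∀ p q →
                   G v p ≡ true → G v q ≡ true → p ≢ q →
                   ¬ (p < v × q < v) × ¬ (v < p × v < q)
    downSides    : ∀ v → twoChildren (δ v) ≡ true → ∀ c → G c v ≡ true →
                   AllBelow G v c ⊎ AllAbove G v c
    downDistinct : ∀ v → twoChildren (δ v) ≡ true → ∀ c d →
                   G c v ≡ true → G d v ≡ true → c ≢ d →
                   ¬ (c < v × d < v) × ¬ (v < c × v < d)

record Permutree {n} (δ : Fin n → Decoration) : Set where
  constructor permutree
  field
    graph       : Graph n
    isPermutree : IsPermutree δ graph
open Permutree public

cutSide : ∀ {n} → Graph n → Fin n → Fin n → Fin n → Bool
cutSide G a b w = connectedIn (adjMinusEdge G a b) a w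

SameCut : ∀ {n} → Graph n → Fin n → Fin n → Graph n → Fin n → Fin n → Set
SameCut G a b G' a' b' = ∀ w → cutSide G a b w ≡ cutSide G' a' b' w

Rotation : ∀ {n} {δ : Fin n → Decoration} → Permutree δ → Permutree δ →
           Fin n → Fin n → Set
Rotation T T' i j =
  i < j × graph T i j ≡ true × graph T' j i ≡ true ×
  (∀ a b → graph T a b ≡ true → ¬ (a ≡ i × b ≡ j) →
     ∃[ a' ] ∃[ b' ] (graph T' a' b' ≡ true × SameCut (graph T) a b (graph T') a' b')) ×
  (∀ a' b' → graph T' a' b' ≡ true → ¬ (a' ≡ j × b' ≡ i) →
     ∃[ a ] ∃[ b ] (graph T a b ≡ true × SameCut (graph T) a b (graph T') a' b'))

IncreasingRotation : ∀ {n} {δ : Fin n → Decoration} → Permutree δ → Permutree δ → Set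
IncreasingRotation {n} T T' = ∃[ i ] ∃[ j ] Rotation T T' i j

_<rot_ : ∀ {n} {δ : Fin n → Decoration} → Permutree δ → Permutree δ → Set
_<rot_ = TransClosure IncreasingRotation

_⋖_ : ∀ {n} {δ : Fin n → Decoration} → Permutree δ → Permutree δ → Set
_⋖_ {δ = δ} T T' = T <rot T' × ¬ (Σ (Permutree δ) λ T'' → T <rot T'' × T'' <rot T')

inD : ∀ {n} → Graph n → Fin n → Fin n → Bool
inD G v w = any (λ c → comp G v c w) (children G v)

inRD : ∀ {n} → Graph n → Fin n → Fin n → Bool
inRD G v w = any (λ c → (v <ᵇ c) ∧ comp G v c w) (children G v)

inC : ∀ {n} → (Fin n → Decoration) → Graph n → Fin n → Fin n → Bool
inC δ G i j with δ i
... | none   = (i <ᵇ j) ∧ inD G i j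
... | up     = (i <ᵇ j) ∧ inD G i j
... | down   = (i <ᵇ j) ∧ inRD G i j
... | updown = (i <ᵇ j) ∧ inRD G i j

cubicComponent : ∀ {n} {δ : Fin n → Decoration} → Permutree δ → Fin n → ℕ
cubicComponent {δ = δ} T i = length (filterᵇ (inC δ (graph T) i) (allFinL _))

cubicVector : ∀ {m} {δ : Fin (suc m) → Decoration} → Permutree δ → Vec ℕ m
cubicVector T = tabulate (λ i → cubicComponent T (inject₁ i))

_<lex_ : ∀ {m} → Vec ℕ m → Vec ℕ m → Set
_<lex_ = Lex-< _≡_ Data.Nat._<_

-- An increasing rotation of the edge i → j preserves every other edge cut, and the cuts determine
-- the descendant subtrees: they stay the same for every vertex other than i and j, j only loses
-- descendants with labels below j (which do not count for c_j), and i keeps its descendants and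
-- gains j. So a rotation increases the cubic vector in coordinate i alone, which gives both the
-- lexicographic increase along the rotation order and the direction e_i of every cover edge.

module Submission where

open import Defs
open import Data.Nat using (ℕ; suc)
open import Data.Fin using (Fin; fromℕ) renaming (zero to fzero)
open import Data.Vec using (lookup)
open import Data.Product using (_×_; ∃-syntax)
open import Relation.Binary.PropositionalEquality using (_≡_; _≢_)

open import Data.Nat as ℕ using (zero; z≤n; s≤s)
import Data.Nat.Properties as ℕ
open import Data.Bool using (Bool; true; false; _∧_; _∨_; not; T)
open import Data.Bool.Properties using (∨-zeroʳ; ∧-zeroʳ; not-¬; T-≡)
open import Data.Bool.ListAction using (any)
import Data.Fin as F
import Data.Fin.Properties as F
open import Data.List as List using (List; []; _∷_; length; filterᵇ; allFin)
open import Data.List.Membership.Propositional using (_∈_)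
open import Data.List.Membership.Propositional.Properties using (∈-allFin; ∈-filter⁺; ∈-filter⁻; ∈-lookup)
import Data.List.Membership.DecPropositional as DecMembership
open import Data.List.Relation.Unary.Any using (here; there)
import Data.List.Relation.Unary.All as All
open import Data.List.Relation.Unary.All.Properties using (¬Any⇒All¬)
open import Data.List.Relation.Unary.Unique.Propositional using (Unique)
import Data.List.Relation.Unary.AllPairs as AllPairs
open import Data.Product using (Σ; _,_; proj₁; proj₂)
open import Data.Sum using (_⊎_; inj₁; inj₂)
open import Data.Vec using (Vec; _∷_)
open import Data.Vec.Properties using (lookup∘tabulate)
import Data.Vec.Relation.Binary.Lex.Strict as Lex
open import Data.Vec.Relation.Binary.Lex.Strict using (this; next)
open import Relation.Binary.Structures using (IsStrictPartialOrder)
open import Relation.Binary.Construct.Closure.Transitive using ([_]; _∷_)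
open import Data.Empty using (⊥; ⊥-elim)
open import Function using (_∘_; Equivalence)
open import Relation.Nullary using (¬_; Dec; yes; no)
open import Relation.Nullary.Decidable using (isYes; T?; _×-dec_)
open import Relation.Binary.PropositionalEquality using (refl; sym; trans; cong; subst; subst₂; module ≡-Reasoning)

private variable
  A : Set

isYes⁺ : (a? : Dec A) → A → isYes a? ≡ true
isYes⁺ (yes _) _ = refl
isYes⁺ (no ¬a) a = ⊥-elim (¬a a)

isYes⁻ : (a? : Dec A) → isYes a? ≡ true → A
isYes⁻ (yes a) _ = a

isYes-false : (a? : Dec A) → ¬ A → isYes a? ≡ false
isYes-false (yes a) ¬a = ⊥-elim (¬a a)
isYes-false (no _)  _  = refl

∨-true⁻ : ∀ {a b} → a ∨ b ≡ true → a ≡ true ⊎ b ≡ true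
∨-true⁻ {true}  _ = inj₁ refl
∨-true⁻ {false} e = inj₂ e

∨-trueˡ : ∀ {a} b → a ≡ true → a ∨ b ≡ true
∨-trueˡ b refl = refl

∨-trueʳ : ∀ a {b} → b ≡ true → a ∨ b ≡ true
∨-trueʳ a refl = ∨-zeroʳ a

∧-true⁻ : ∀ {a b} → a ∧ b ≡ true → a ≡ true × b ≡ true
∧-true⁻ {true} e = refl , e

∧-true⁺ : ∀ {a b} → a ≡ true → b ≡ true → a ∧ b ≡ true
∧-true⁺ refl e = e

not-true⁻ : ∀ {a} → not a ≡ true → a ≡ false
not-true⁻ {false} _ = refl

⇔-true⇒≡ : ∀ {a b} → (a ≡ true → b ≡ true) → (b ≡ true → a ≡ true) → a ≡ b
⇔-true⇒≡ {true}          a⇒b _   = sym (a⇒b refl)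
⇔-true⇒≡ {false} {true}  _   b⇒a = b⇒a refl
⇔-true⇒≡ {false} {false} _   _   = refl

any⁺ : (p : A → Bool) {x : A} {xs : List A} → x ∈ xs → p x ≡ true → any p xs ≡ true
any⁺ p {xs = _ ∷ ys} (here refl) e = ∨-trueˡ (any p ys) e
any⁺ p {xs = y ∷ _}  (there x∈)  e = ∨-trueʳ (p y) (any⁺ p x∈ e)

any⁻ : (p : A → Bool) (xs : List A) → any p xs ≡ true → ∃[ x ] (x ∈ xs × p x ≡ true)
any⁻ p (y ∷ ys) e with ∨-true⁻ {p y} e
... | inj₁ py = y , here refl , py
... | inj₂ rest with any⁻ p ys rest
... | x , x∈ , px = x , there x∈ , px

∈-filterᵇ⁺ : (p : A → Bool) {x : A} {xs : List A} → x ∈ xs → p x ≡ true → x ∈ filterᵇ p xs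
∈-filterᵇ⁺ p x∈ e = ∈-filter⁺ (T? ∘ p) x∈ (subst T (sym e) _)

∈-filterᵇ⁻ : (p : A → Bool) {x : A} {xs : List A} → x ∈ filterᵇ p xs → p x ≡ true
∈-filterᵇ⁻ p {xs = xs} x∈ = Equivalence.to T-≡ (proj₂ (∈-filter⁻ (T? ∘ p) {xs = xs} x∈))

length-filterᵇ-cong : (p q : A → Bool) (xs : List A) → (∀ x → p x ≡ q x) →
                      length (filterᵇ p xs) ≡ length (filterᵇ q xs)
length-filterᵇ-cong p q []       p≗q = refl
length-filterᵇ-cong p q (x ∷ xs) p≗q rewrite p≗q x with q x
... | true  = cong suc (length-filterᵇ-cong p q xs p≗q)
... | false = length-filterᵇ-cong p q xs p≗q

length-filterᵇ-mono : (p q : A → Bool) (xs : List A) → (∀ x → p x ≡ true → q x ≡ true) →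
                      length (filterᵇ p xs) ℕ.≤ length (filterᵇ q xs)
length-filterᵇ-mono p q []       p⇒q = z≤n
length-filterᵇ-mono p q (x ∷ xs) p⇒q with p x in px | q x in qx
... | true  | true  = s≤s (length-filterᵇ-mono p q xs p⇒q)
... | true  | false = ⊥-elim (not-¬ (p⇒q x px) qx)
... | false | true  = ℕ.m≤n⇒m≤1+n (length-filterᵇ-mono p q xs p⇒q)
... | false | false = length-filterᵇ-mono p q xs p⇒q

length-filterᵇ-strict : (p q : A → Bool) (xs : List A) → (∀ x → p x ≡ true → q x ≡ true) →
                        ∀ {y} → y ∈ xs → p y ≡ false → q y ≡ true →
                        length (filterᵇ p xs) ℕ.< length (filterᵇ q xs)
length-filterᵇ-strict p q (x ∷ xs) p⇒q (here refl) py qy rewrite py | qy =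
  s≤s (length-filterᵇ-mono p q xs p⇒q)
length-filterᵇ-strict p q (x ∷ xs) p⇒q (there y∈) py qy with p x in px | q x in qx
... | true  | true  = s≤s (length-filterᵇ-strict p q xs p⇒q y∈ py qy)
... | true  | false = ⊥-elim (not-¬ (p⇒q x px) qx)
... | false | true  = ℕ.m≤n⇒m≤1+n (length-filterᵇ-strict p q xs p⇒q y∈ py qy)
... | false | false = length-filterᵇ-strict p q xs p⇒q y∈ py qy

Unique⇒length≤ : ∀ {n} (xs : List (Fin n)) → Unique xs → length xs ℕ.≤ n
Unique⇒length≤ {n} xs xs! with length xs ℕ.≤? n
... | yes ≤n = ≤n
... | no  ≰n with F.pigeonhole (ℕ.≰⇒> ≰n) (List.lookup xs)
... | i , j , i<j , same = ⊥-elim (F.<⇒≢ i<j (lookup-injective xs xs! same))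
  where
  lookup-injective : ∀ {B : Set} (ys : List B) → Unique ys → ∀ {k l} → List.lookup ys k ≡ List.lookup ys l → k ≡ l
  lookup-injective (y ∷ ys) ys!             {fzero}  {fzero}  _ = refl
  lookup-injective (y ∷ ys) (y∉ AllPairs.∷ _) {fzero}  {F.suc l} e = ⊥-elim (All.lookup y∉ (∈-lookup {xs = ys} l) e)
  lookup-injective (y ∷ ys) (y∉ AllPairs.∷ _) {F.suc k} {fzero}  e = ⊥-elim (All.lookup y∉ (∈-lookup {xs = ys} k) (sym e))
  lookup-injective (y ∷ ys) (_ AllPairs.∷ ys!) {F.suc k} {F.suc l} e = cong F.suc (lookup-injective ys ys! e)

-- Walks and connectivity

module _ {n : ℕ} where

  data Walk (R : Fin n → Fin n → Bool) : Fin n → Fin n → Set where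
    []  : ∀ {u} → Walk R u u
    _▷_ : ∀ {u v w} → Walk R u v → R v w ≡ true → Walk R u w

  infixl 5 _▷_

  module _ {R : Fin n → Fin n → Bool} where

    walkLength : ∀ {u w} → Walk R u w → ℕ
    walkLength []      = 0
    walkLength (p ▷ _) = suc (walkLength p)

    vertices : ∀ {u w} → Walk R u w → List (Fin n)
    vertices {u}     []      = u ∷ []
    vertices {w = w} (p ▷ _) = w ∷ vertices p

    length-vertices : ∀ {u w} (p : Walk R u w) → length (vertices p) ≡ suc (walkLength p)
    length-vertices []      = refl
    length-vertices (p ▷ _) = cong suc (length-vertices p)

    reach⇒walk : ∀ k {u w} → reach R k u w ≡ true → Walk R u w
    reach⇒walk zero    {u} {w} e = subst (Walk R u) (isYes⁻ (u F.≟ w) e) []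
    reach⇒walk (suc k) {u} {w} e with ∨-true⁻ {reach R k u w} e
    ... | inj₁ shorter = reach⇒walk k shorter
    ... | inj₂ longer with any⁻ (λ v → reach R k u v ∧ R v w) (allFin n) longer
    ... | v , _ , lastStep with ∧-true⁻ {reach R k u v} lastStep
    ... | uv , vw = reach⇒walk k uv ▷ vw

    walk⇒reach : ∀ k {u w} (p : Walk R u w) → walkLength p ℕ.≤ k → reach R k u w ≡ true
    walk⇒reach zero    {u} []      _        = isYes⁺ (u F.≟ u) refl
    walk⇒reach (suc k)     []      _        = ∨-trueˡ _ (walk⇒reach k [] z≤n)
    walk⇒reach (suc k) {u} {w} (_▷_ {v = v} p vw) (s≤s ≤k) =
      ∨-trueʳ (reach R k u w)
        (any⁺ (λ x → reach R k u x ∧ R x w) (∈-allFin v) (∧-true⁺ (walk⇒reach k p ≤k) vw))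

    SimpleWalk : Fin n → Fin n → Set
    SimpleWalk u w = Σ (Walk R u w) (Unique ∘ vertices)

    truncate : ∀ {u v x} (p : Walk R u v) → x ∈ vertices p → Unique (vertices p) → SimpleWalk u x
    truncate []      (here refl) p! = [] , p!
    truncate (p ▷ e) (here refl) p! = p ▷ e , p!
    truncate (p ▷ _) (there x∈)  (_ AllPairs.∷ p!) = truncate p x∈ p!

    loopErase : ∀ {u w} → Walk R u w → SimpleWalk u w
    loopErase [] = [] , (All.[] AllPairs.∷ AllPairs.[])
    loopErase {w = w} (p ▷ vw) with loopErase p
    ... | q , q! with DecMembership._∈?_ F._≟_ w (vertices q)
    ... | yes w∈ = truncate q w∈ q!
    ... | no  w∉ = q ▷ vw , (¬Any⇒All¬ _ w∉ AllPairs.∷ q!)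

    walk⇒connected : ∀ {u w} → Walk R u w → connectedIn R u w ≡ true
    walk⇒connected p with loopErase p
    ... | q , q! = walk⇒reach n q (ℕ.≤-trans (ℕ.n≤1+n _)
                     (subst (ℕ._≤ n) (length-vertices q) (Unique⇒length≤ (vertices q) q!)))

    connected⇒walk : ∀ {u w} → connectedIn R u w ≡ true → Walk R u w
    connected⇒walk = reach⇒walk n

  _++ʷ_ : ∀ {R u v w} → Walk R u v → Walk R v w → Walk R u w
  p ++ʷ []       = p
  p ++ʷ (q ▷ e)  = (p ++ʷ q) ▷ e

  mapʷ : ∀ {R S} → (∀ {x y} → R x y ≡ true → S x y ≡ true) → ∀ {u w} → Walk R u w → Walk S u w
  mapʷ f []      = []
  mapʷ f (p ▷ e) = mapʷ f p ▷ f e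

  reverseʷ : ∀ {R} → (∀ {x y} → R x y ≡ true → R y x ≡ true) → ∀ {u w} → Walk R u w → Walk R w u
  reverseʷ sym-R []      = []
  reverseʷ sym-R (p ▷ e) = ([] ▷ sym-R e) ++ʷ reverseʷ sym-R p

-- Trees

module _ {n : ℕ} (G : Graph n) where

  adj-sym : ∀ {x y} → adj G x y ≡ true → adj G y x ≡ true
  adj-sym {x} {y} xy with ∨-true⁻ {G x y} xy
  ... | inj₁ x→y = ∨-trueʳ (G y x) x→y
  ... | inj₂ y→x = ∨-trueˡ (G x y) y→x

  edge⇒adj : ∀ {x y} → G x y ≡ true → adj G x y ≡ true
  edge⇒adj {x} {y} = ∨-trueˡ (G y x)

  edge⇒adj˘ : ∀ {x y} → G y x ≡ true → adj G x y ≡ true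
  edge⇒adj˘ {x} {y} = ∨-trueʳ (G x y)

  private
    isEdge-false : ∀ (x a y b : Fin n) → ¬ (x ≡ a × y ≡ b) → (x == a ∧ y == b) ≡ false
    isEdge-false x a y b ne with x F.≟ a | y F.≟ b
    ... | yes p | yes q = ⊥-elim (ne (p , q))
    ... | yes _ | no _  = refl
    ... | no _  | _     = refl

    isEdge-refl : ∀ (x y : Fin n) → (x == x ∧ y == y) ≡ true
    isEdge-refl x y = ∧-true⁺ (isYes⁺ (x F.≟ x) refl) (isYes⁺ (y F.≟ y) refl)

  adjMinusEdge⁻ : ∀ {a b x y} → adjMinusEdge G a b x y ≡ true →
                  adj G x y ≡ true × ¬ (x ≡ a × y ≡ b) × ¬ (x ≡ b × y ≡ a)
  adjMinusEdge⁻ {a} {b} {x} {y} e with ∧-true⁻ {adj G x y} e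
  ... | xy , notRemoved =
    xy , (λ { (refl , refl) → not-¬ (∨-trueˡ _ (isEdge-refl x y)) (not-true⁻ notRemoved) })
       , (λ { (refl , refl) → not-¬ (∨-trueʳ _ (isEdge-refl x y)) (not-true⁻ notRemoved) })

  adjMinusEdge⁺ : ∀ {a b x y} → adj G x y ≡ true → ¬ (x ≡ a × y ≡ b) → ¬ (x ≡ b × y ≡ a) →
                  adjMinusEdge G a b x y ≡ true
  adjMinusEdge⁺ {a} {b} {x} {y} xy ≢ab ≢ba
    rewrite isEdge-false x a y b ≢ab | isEdge-false x b y a ≢ba = ∧-true⁺ xy refl

  adjMinusEdge-sym : ∀ {a b x y} → adjMinusEdge G a b x y ≡ true → adjMinusEdge G a b y x ≡ true
  adjMinusEdge-sym e with adjMinusEdge⁻ e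
  ... | xy , ≢ab , ≢ba = adjMinusEdge⁺ (adj-sym xy) (λ (p , q) → ≢ba (q , p)) (λ (p , q) → ≢ab (q , p))

  adjMinusEdge-swap : ∀ {a b x y} → adjMinusEdge G a b x y ≡ true → adjMinusEdge G b a x y ≡ true
  adjMinusEdge-swap e with adjMinusEdge⁻ e
  ... | xy , ≢ab , ≢ba = adjMinusEdge⁺ xy ≢ba ≢ab

  adjMinusVertex⁻ : ∀ {v x y} → adjMinusVertex G v x y ≡ true → adj G x y ≡ true × x ≢ v × y ≢ v
  adjMinusVertex⁻ {v} {x} {y} e with ∧-true⁻ {adj G x y} e
  ... | xy , rest with ∧-true⁻ {not (x == v)} rest
  ... | x≠v , y≠v = xy , (λ { refl → not-¬ (isYes⁺ (x F.≟ x) refl) (not-true⁻ x≠v) })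
                       , (λ { refl → not-¬ (isYes⁺ (y F.≟ y) refl) (not-true⁻ y≠v) })

  adjMinusVertex⁺ : ∀ {v x y} → adj G x y ≡ true → x ≢ v → y ≢ v → adjMinusVertex G v x y ≡ true
  adjMinusVertex⁺ {v} {x} {y} xy x≢v y≢v
    rewrite isYes-false (x F.≟ v) x≢v | isYes-false (y F.≟ v) y≢v = ∧-true⁺ xy refl

  adjMinusVertex-sym : ∀ {v x y} → adjMinusVertex G v x y ≡ true → adjMinusVertex G v y x ≡ true
  adjMinusVertex-sym e with adjMinusVertex⁻ e
  ... | xy , x≢v , y≢v = adjMinusVertex⁺ (adj-sym xy) y≢v x≢v

module TreeProperties {n : ℕ} {G : Graph n} (tree : IsTree G) where

  private
    loopless : ∀ a → G a a ≡ false
    loopless = proj₁ tree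

    connected : ∀ a b → connectedIn (adj G) a b ≡ true
    connected = proj₁ (proj₂ (proj₂ tree))

    bridges : ∀ a b → G a b ≡ true → connectedIn (adjMinusEdge G a b) a b ≡ false
    bridges = proj₂ (proj₂ (proj₂ tree))

  edge-asym : ∀ {a b} → G a b ≡ true → G b a ≡ false
  edge-asym = proj₁ (proj₂ tree) _ _

  adj-irrefl : ∀ {x y} → adj G x y ≡ true → x ≢ y
  adj-irrefl {x} xy refl with ∨-true⁻ {G x x} xy
  ... | inj₁ loop = not-¬ loop (loopless x)
  ... | inj₂ loop = not-¬ loop (loopless x)

  noDetour : ∀ {a b} → adj G a b ≡ true → ¬ Walk (adjMinusEdge G a b) a b
  noDetour {a} {b} ab p with ∨-true⁻ {G a b} ab
  ... | inj₁ a→b = not-¬ (walk⇒connected p) (bridges a b a→b)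
  ... | inj₂ b→a = not-¬ (walk⇒connected (reverseʷ (adjMinusEdge-sym G) (mapʷ (adjMinusEdge-swap G) p)))
                         (bridges b a b→a)

  cutSide-source : ∀ a b → cutSide G a b a ≡ true
  cutSide-source a b = walk⇒connected {R = adjMinusEdge G a b} []

  cutSide-target : ∀ {a b} → adj G a b ≡ true → cutSide G a b b ≡ false
  cutSide-target {a} {b} ab with cutSide G a b b in b∈
  ... | true  = ⊥-elim (noDetour ab (connected⇒walk b∈))
  ... | false = refl

  cutSide-disjoint : ∀ {a b w} → adj G a b ≡ true → cutSide G a b w ≡ true → cutSide G b a w ≡ true → ⊥
  cutSide-disjoint ab aw bw =
    noDetour ab (connected⇒walk aw ++ʷ
                 reverseʷ (adjMinusEdge-sym G) (mapʷ (adjMinusEdge-swap G) (connected⇒walk bw)))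

  private
    sideOf : ∀ {a b x} → Walk (adj G) a x → Walk (adjMinusEdge G a b) a x ⊎ Walk (adjMinusEdge G a b) b x
    sideOf [] = inj₁ []
    sideOf {a} {b} (_▷_ {v = x} {w = y} p xy) with x F.≟ a ×-dec y F.≟ b | x F.≟ b ×-dec y F.≟ a
    ... | yes (refl , refl) | _                  = inj₂ []
    ... | no _              | yes (refl , refl)  = inj₁ []
    ... | no ≢ab            | no ≢ba with sideOf p
    ...   | inj₁ fromA = inj₁ (fromA ▷ adjMinusEdge⁺ G xy ≢ab ≢ba)
    ...   | inj₂ fromB = inj₂ (fromB ▷ adjMinusEdge⁺ G xy ≢ab ≢ba)

  cutSide-swap : ∀ {a b} → adj G a b ≡ true → ∀ w → cutSide G b a w ≡ not (cutSide G a b w)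
  cutSide-swap {a} {b} ab w with cutSide G a b w in aw | cutSide G b a w in bw
  ... | true  | true  = ⊥-elim (cutSide-disjoint ab aw bw)
  ... | true  | false = refl
  ... | false | true  = refl
  ... | false | false with sideOf {b = b} (connected⇒walk (connected a w))
  ...   | inj₁ fromA = ⊥-elim (not-¬ (walk⇒connected fromA) aw)
  ...   | inj₂ fromB = ⊥-elim (not-¬ (walk⇒connected (mapʷ (adjMinusEdge-swap G) fromB)) bw)

  cutSide-crossing : ∀ {a b x y} → adj G a b ≡ true → cutSide G a b x ≡ true → cutSide G a b y ≡ false →
                     adj G x y ≡ true → x ≡ a × y ≡ b
  cutSide-crossing {a} {b} {x} {y} ab ax ay xy with x F.≟ a ×-dec y F.≟ b | x F.≟ b ×-dec y F.≟ a
  ... | yes same | _                 = same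
  ... | no _     | yes (refl , refl) = ⊥-elim (not-¬ ax (cutSide-target ab))
  ... | no ≢ab   | no ≢ba            =
    ⊥-elim (not-¬ (walk⇒connected (connected⇒walk {R = adjMinusEdge G a b} ax ▷ adjMinusEdge⁺ G xy ≢ab ≢ba)) ay)

  cutSide-neighbour : ∀ {c k x} → adj G c k ≡ true → adj G x k ≡ true → x ≢ c → cutSide G c k x ≡ false
  cutSide-neighbour {c} {k} {x} ck xk x≢c with cutSide G c k x in cx
  ... | false = refl
  ... | true  = ⊥-elim (x≢c (proj₁ (cutSide-crossing ck cx (cutSide-target ck) xk)))

  cutSide-adjacentEdge : ∀ {a b e k} → adj G a b ≡ true → adj G e k ≡ true → e ≢ a → e ≢ b → k ≡ a ⊎ k ≡ b →
                         ∀ {v} → v ≡ a ⊎ v ≡ b → cutSide G e k v ≡ false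
  cutSide-adjacentEdge ab ek e≢a e≢b (inj₁ refl) (inj₁ refl) = cutSide-target ek
  cutSide-adjacentEdge ab ek e≢a e≢b (inj₁ refl) (inj₂ refl) = cutSide-neighbour ek (adj-sym G ab) (λ b≡e → e≢b (sym b≡e))
  cutSide-adjacentEdge ab ek e≢a e≢b (inj₂ refl) (inj₁ refl) = cutSide-neighbour ek ab (λ a≡e → e≢a (sym a≡e))
  cutSide-adjacentEdge ab ek e≢a e≢b (inj₂ refl) (inj₂ refl) = cutSide-target ek

  comp-refl : ∀ k u → comp G k u u ≡ true
  comp-refl k u = walk⇒connected {R = adjMinusVertex G k} []

  comp-trans : ∀ {k u v w} → comp G k u v ≡ true → comp G k v w ≡ true → comp G k u w ≡ true
  comp-trans {k} uv vw = walk⇒connected (connected⇒walk {R = adjMinusVertex G k} uv ++ʷ connected⇒walk vw)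

  comp⇒cutSide : ∀ {d k u} → comp G k d u ≡ true → cutSide G d k u ≡ true
  comp⇒cutSide {d} {k} du = walk⇒connected (mapʷ avoidsEdge (connected⇒walk {R = adjMinusVertex G k} du))
    where
    avoidsEdge : ∀ {x y} → adjMinusVertex G k x y ≡ true → adjMinusEdge G d k x y ≡ true
    avoidsEdge e with adjMinusVertex⁻ G e
    ... | xy , x≢k , y≢k = adjMinusEdge⁺ G xy (λ r → y≢k (proj₂ r)) (λ r → x≢k (proj₁ r))

  cutSide⇒comp : ∀ {a b k u w} → cutSide G a b u ≡ true → cutSide G a b w ≡ true →
                 cutSide G a b k ≡ false → comp G k u w ≡ true
  cutSide⇒comp {a} {b} {k} au aw ak =
    walk⇒connected (avoiding (connected⇒walk au) (reverseʷ (adjMinusEdge-sym G) (connected⇒walk au) ++ʷ connected⇒walk aw))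
    where
    notK : ∀ {z} → Walk (adjMinusEdge G a b) a z → z ≢ k
    notK p refl = not-¬ (walk⇒connected p) ak
    avoiding : ∀ {x y} → Walk (adjMinusEdge G a b) a x → Walk (adjMinusEdge G a b) x y → Walk (adjMinusVertex G k) x y
    avoiding toX []      = []
    avoiding toX (p ▷ e) =
      avoiding toX p ▷ adjMinusVertex⁺ G (proj₁ (adjMinusEdge⁻ G e)) (notK (toX ++ʷ p)) (notK ((toX ++ʷ p) ▷ e))

  comp-disjoint : ∀ {a b w} → adj G a b ≡ true → comp G a b w ≡ true → comp G b a w ≡ true → ⊥
  comp-disjoint ab bw aw = cutSide-disjoint ab (comp⇒cutSide aw) (comp⇒cutSide bw)

  private
    endAvoids : ∀ {k d x} → d ≢ k → Walk (adjMinusVertex G k) d x → x ≢ k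
    endAvoids d≢k []      = d≢k
    endAvoids d≢k (p ▷ e) = proj₂ (proj₂ (adjMinusVertex⁻ G e))

    lastExit : ∀ {k x} → Walk (adj G) k x → x ≡ k ⊎ ∃[ d ] (adj G k d ≡ true × Walk (adjMinusVertex G k) d x)
    lastExit [] = inj₁ refl
    lastExit {k} (_▷_ {w = y} p xy) with y F.≟ k
    ... | yes y≡k = inj₁ y≡k
    ... | no  y≢k with lastExit p
    ...   | inj₁ refl           = inj₂ (y , xy , [])
    ...   | inj₂ (d , kd , d⇝x) =
      inj₂ (d , kd , d⇝x ▷ adjMinusVertex⁺ G xy (endAvoids (λ d≡k → adj-irrefl kd (sym d≡k)) d⇝x) y≢k)

  comp-avoids : ∀ {c k w} → c ≢ k → comp G k c w ≡ true → w ≢ k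
  comp-avoids c≢k cw = endAvoids c≢k (connected⇒walk cw)

  lastNeighbour : ∀ k w → w ≢ k → ∃[ d ] (adj G k d ≡ true × comp G k d w ≡ true)
  lastNeighbour k w w≢k with lastExit (connected⇒walk (connected k w))
  ... | inj₁ w≡k           = ⊥-elim (w≢k w≡k)
  ... | inj₂ (d , kd , d⇝w) = d , kd , walk⇒connected d⇝w

module _ {n : ℕ} (G : Graph n) where

  inD⁻ : ∀ {k w} → inD G k w ≡ true → ∃[ c ] (G c k ≡ true × comp G k c w ≡ true)
  inD⁻ {k} {w} kw with any⁻ (λ c → comp G k c w) (children G k) kw
  ... | c , c∈ , cw = c , ∈-filterᵇ⁻ (λ c → G c k) {xs = allFin n} c∈ , cw

  inD⁺ : ∀ {k w c} → G c k ≡ true → comp G k c w ≡ true → inD G k w ≡ true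
  inD⁺ {k} {w} {c} c→k cw = any⁺ (λ c → comp G k c w) (∈-filterᵇ⁺ (λ c → G c k) (∈-allFin c) c→k) cw

-- Trees with the same edge cuts

PreservesCuts : ∀ {n} → Graph n → Graph n → Fin n → Fin n → Set
PreservesCuts G G' p q = ∀ a b → G a b ≡ true → ¬ (a ≡ p × b ≡ q) →
  ∃[ a' ] ∃[ b' ] (G' a' b' ≡ true × SameCut G a b G' a' b')

preservesCuts-adj : ∀ {n} {G G' : Graph n} → IsTree G → IsTree G' → ∀ {p q} → PreservesCuts G G' p q →
                    ∀ {x y} → adj G x y ≡ true → ¬ (x ≡ p × y ≡ q) → ¬ (x ≡ q × y ≡ p) →
                    ∃[ a' ] ∃[ b' ] (adj G' a' b' ≡ true × SameCut G x y G' a' b')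
preservesCuts-adj {G = G} {G'} tree tree' keep {x} {y} xy ≢pq ≢qp with ∨-true⁻ {G x y} xy
... | inj₁ x→y with keep x y x→y ≢pq
...   | a' , b' , a'→b' , same = a' , b' , edge⇒adj G' a'→b' , same
preservesCuts-adj {G = G} {G'} tree tree' keep {x} {y} xy ≢pq ≢qp | inj₂ y→x
  with keep y x y→x (λ (p , q) → ≢qp (q , p))
...   | a' , b' , a'→b' , same = b' , a' , edge⇒adj˘ G' a'→b' , λ w → begin
  cutSide G x y w          ≡⟨ TreeProperties.cutSide-swap tree (edge⇒adj G y→x) w ⟩
  not (cutSide G y x w)    ≡⟨ cong not (same w) ⟩
  not (cutSide G' a' b' w) ≡⟨ sym (TreeProperties.cutSide-swap tree' (edge⇒adj G' a'→b') w) ⟩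
  cutSide G' b' a' w       ∎
  where open ≡-Reasoning

module CutTransport {n : ℕ} {G G' : Graph n} (tree : IsTree G) (tree' : IsTree G') where
  private
    module T  = TreeProperties tree
    module T' = TreeProperties tree'

  -- The y-side of {y,z} avoids k, so it lies in the component of w in G ∖ k, i.e. on c's side of c → k;
  -- hence {y,z} crosses the cut of c → k transported to G', so it is that edge.
  matchingEdge : ∀ {p q p' q'} → PreservesCuts G G' p q → PreservesCuts G' G p' q' →
                 ∀ {c k w y z} → G c k ≡ true → ¬ (c ≡ p × k ≡ q) → comp G k c w ≡ true →
                 adj G' y z ≡ true → ¬ (y ≡ p' × z ≡ q') → ¬ (y ≡ q' × z ≡ p') → comp G' z y w ≡ true →
                 cutSide G c k z ≡ false → cutSide G' y z k ≡ false →
                 G' y z ≡ true × comp G k c y ≡ true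
  matchingEdge keep keep' {c} {k} {w} {y} {z} c→k ≢pq cw yz ≢p'q' ≢q'p' yw zNotC kNotY
    with keep c k c→k ≢pq
       | preservesCuts-adj tree' tree keep' (adj-sym G' yz) (λ (p , q) → ≢q'p' (q , p))
                                        (λ (p , q) → ≢p'q' (q , p))
  ... | a' , b' , a'→b' , sameCK | a , b , ab , sameZY = final (T'.cutSide-crossing (edge⇒adj G' a'→b') a'y a'z yz)
    where
    bSide : ∀ v → cutSide G b a v ≡ cutSide G' y z v
    bSide v = begin
      cutSide G b a v          ≡⟨ T.cutSide-swap ab v ⟩
      not (cutSide G a b v)    ≡⟨ cong not (sym (sameZY v)) ⟩
      not (cutSide G' z y v)   ≡⟨ sym (T'.cutSide-swap (adj-sym G' yz) v) ⟩
      cutSide G' y z v         ∎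
      where open ≡-Reasoning
    cy : comp G k c y ≡ true
    cy = T.comp-trans cw (T.cutSide⇒comp (trans (bSide w) (T'.comp⇒cutSide yw))
                                         (trans (bSide y) (T'.cutSide-source y z))
                                         (trans (bSide k) kNotY))
    a'y : cutSide G' a' b' y ≡ true
    a'y = trans (sym (sameCK y)) (T.comp⇒cutSide cy)
    a'z : cutSide G' a' b' z ≡ false
    a'z = trans (sym (sameCK z)) zNotC
    final : y ≡ a' × z ≡ b' → G' y z ≡ true × comp G k c y ≡ true
    final (refl , refl) = a'→b' , cy

  inD-transport : ∀ {p q p' q'} → PreservesCuts G G' p q → PreservesCuts G' G p' q' →
                  ∀ {k w} → k ≢ q → inD G k w ≡ true →
                  inD G' k w ≡ true ⊎ ∃[ d ] (((d ≡ p' × k ≡ q') ⊎ (d ≡ q' × k ≡ p')) × comp G' k d w ≡ true)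
  inD-transport {p' = p'} {q'} keep keep' {k} {w} k≢q kw with inD⁻ G kw
  ... | c , c→k , cw with T'.lastNeighbour k w (T.comp-avoids (T.adj-irrefl (edge⇒adj G c→k)) cw)
  ... | d , kd , dw with d F.≟ p' ×-dec k F.≟ q' | d F.≟ q' ×-dec k F.≟ p'
  ... | yes exempt | _          = inj₂ (d , inj₁ exempt , dw)
  ... | no _       | yes exempt = inj₂ (d , inj₂ exempt , dw)
  ... | no ≢p'q'   | no ≢q'p'   =
    inj₁ (inD⁺ G' (proj₁ (matchingEdge keep keep' c→k (λ r → k≢q (proj₂ r)) cw (adj-sym G' kd) ≢p'q' ≢q'p' dw
                           (T.cutSide-target (edge⇒adj G c→k)) (T'.cutSide-target (adj-sym G' kd)))) dw)

-- Permutrees and rotations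

private
  twoChildSlots : ∀ d → 2 ℕ.≤ childSlots d → twoChildren d ≡ true
  twoChildSlots none   (s≤s ())
  twoChildSlots down   _ = refl
  twoChildSlots up     (s≤s ())
  twoChildSlots updown _ = refl

  twoParentSlots : ∀ d → 2 ℕ.≤ parentSlots d → twoParents d ≡ true
  twoParentSlots none   (s≤s ())
  twoParentSlots down   (s≤s ())
  twoParentSlots up     _ = refl
  twoParentSlots updown _ = refl

  2≤length : ∀ {x y : A} {xs} → x ∈ xs → y ∈ xs → x ≢ y → 2 ℕ.≤ length xs
  2≤length (here refl) (here refl)        x≢y = ⊥-elim (x≢y refl)
  2≤length (here _)    (there (here _))   _   = s≤s (s≤s z≤n)
  2≤length (here _)    (there (there _))  _   = s≤s (s≤s z≤n)
  2≤length (there (here _))  (here _)     _   = s≤s (s≤s z≤n)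
  2≤length (there (there _)) (here _)     _   = s≤s (s≤s z≤n)
  2≤length (there x∈)  (there y∈)         x≢y = ℕ.m≤n⇒m≤1+n (2≤length x∈ y∈ x≢y)

module PermutreeProperties {n : ℕ} {δ : Fin n → Decoration} {G : Graph n} (P : IsPermutree δ G) where
  open IsPermutree P

  twoChildren-of : ∀ {c d k} → G c k ≡ true → G d k ≡ true → c ≢ d → twoChildren (δ k) ≡ true
  twoChildren-of {c} {d} {k} c→k d→k c≢d = twoChildSlots (δ k) (ℕ.≤-trans
    (2≤length (∈-filterᵇ⁺ (λ x → G x k) (∈-allFin c) c→k) (∈-filterᵇ⁺ (λ x → G x k) (∈-allFin d) d→k) c≢d)
    (childCount k))

  twoParents-of : ∀ {p q k} → G k p ≡ true → G k q ≡ true → p ≢ q → twoParents (δ k) ≡ true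
  twoParents-of {p} {q} {k} k→p k→q p≢q = twoParentSlots (δ k) (ℕ.≤-trans
    (2≤length (∈-filterᵇ⁺ (λ x → G k x) (∈-allFin p) k→p) (∈-filterᵇ⁺ (λ x → G k x) (∈-allFin q) k→q) p≢q)
    (parentCount k))

  rightDescendantsAbove : ∀ k w → twoChildren (δ k) ≡ true →
                          (k <ᵇ w) ∧ inRD G k w ≡ (k <ᵇ w) ∧ inD G k w
  rightDescendantsAbove k w twoC with k F.<? w
  ... | no  _   = refl
  ... | yes k<w = ⇔-true⇒≡ right⇒any any⇒right
    where
    right⇒any : inRD G k w ≡ true → inD G k w ≡ true
    right⇒any kw with any⁻ (λ c → (k <ᵇ c) ∧ comp G k c w) (children G k) kw
    ... | c , c∈ , cw = inD⁺ G (∈-filterᵇ⁻ (λ c → G c k) {xs = allFin n} c∈) (proj₂ (∧-true⁻ {k <ᵇ c} cw))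
    any⇒right : inD G k w ≡ true → inRD G k w ≡ true
    any⇒right kw with inD⁻ G kw
    ... | c , c→k , cw with downSides k twoC c c→k
    ...   | inj₁ below = ⊥-elim (F.<-asym (below w cw) k<w)
    ...   | inj₂ above = any⁺ (λ c → (k <ᵇ c) ∧ comp G k c w) (∈-filterᵇ⁺ (λ c → G c k) (∈-allFin c) c→k)
                              (∧-true⁺ (isYes⁺ (k F.<? c) (above c (TreeProperties.comp-refl tree k c))) cw)

  -- C(T)_k only counts labels above k, and a left descendant subtree only has labels below k,
  -- so the decoration of k does not matter.
  inC≡<ᵇ∧inD : ∀ k w → inC δ G k w ≡ (k <ᵇ w) ∧ inD G k w
  inC≡<ᵇ∧inD k w with δ k in δk
  ... | none   = refl
  ... | up     = refl
  ... | down   = rightDescendantsAbove k w (subst (λ d → twoChildren d ≡ true) (sym δk) refl)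
  ... | updown = rightDescendantsAbove k w (subst (λ d → twoChildren d ≡ true) (sym δk) refl)

module _ {n : ℕ} {δ : Fin n → Decoration} (T T' : Permutree δ) (k : Fin n) where
  private
    G G' : Graph n
    G  = graph T
    G' = graph T'

    countAbove : Permutree δ → ℕ
    countAbove S = length (filterᵇ (λ w → (k <ᵇ w) ∧ inD (graph S) k w) (allFin n))

    cubicComponent≡countAbove : ∀ S → cubicComponent S k ≡ countAbove S
    cubicComponent≡countAbove S =
      length-filterᵇ-cong _ _ (allFin n) (PermutreeProperties.inC≡<ᵇ∧inD (isPermutree S) k)

  cubicComponent-cong : (∀ w → k F.< w → inD G k w ≡ inD G' k w) → cubicComponent T k ≡ cubicComponent T' k
  cubicComponent-cong same = begin
    cubicComponent T k   ≡⟨ cubicComponent≡countAbove T ⟩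
    countAbove T         ≡⟨ length-filterᵇ-cong _ _ (allFin n) sameAbove ⟩
    countAbove T'        ≡⟨ sym (cubicComponent≡countAbove T') ⟩
    cubicComponent T' k  ∎
    where
    open ≡-Reasoning
    sameAbove : ∀ w → (k <ᵇ w) ∧ inD G k w ≡ (k <ᵇ w) ∧ inD G' k w
    sameAbove w with k F.<? w
    ... | yes k<w = same w k<w
    ... | no  _   = refl

  cubicComponent-< : (∀ w → inD G k w ≡ true → inD G' k w ≡ true) →
                     ∀ {j} → k F.< j → inD G k j ≡ false → inD G' k j ≡ true →
                     cubicComponent T k ℕ.< cubicComponent T' k
  cubicComponent-< grow {j} k<j notBefore after =
    subst₂ ℕ._<_ (sym (cubicComponent≡countAbove T)) (sym (cubicComponent≡countAbove T'))
      (length-filterᵇ-strict _ _ (allFin n) growAbove (∈-allFin j)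
        (trans (cong ((k <ᵇ j) ∧_) notBefore) (∧-zeroʳ (k <ᵇ j)))
        (∧-true⁺ (isYes⁺ (k F.<? j) k<j) after))
    where
    growAbove : ∀ w → (k <ᵇ w) ∧ inD G k w ≡ true → (k <ᵇ w) ∧ inD G' k w ≡ true
    growAbove w kw with ∧-true⁻ {k <ᵇ w} kw
    ... | k<w , before = ∧-true⁺ k<w (grow w before)

module RotationProperties {n : ℕ} {δ : Fin n → Decoration} (T T' : Permutree δ) (i j : Fin n)
                          (rot : Rotation T T' i j) where
  private
    G G' : Graph n
    G  = graph T
    G' = graph T'

    P : IsPermutree δ G
    P = isPermutree T

    P' : IsPermutree δ G'
    P' = isPermutree T'

    module Old = TreeProperties (IsPermutree.tree P)
    module New = TreeProperties (IsPermutree.tree P')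

    i<j : i F.< j
    i<j = proj₁ rot

    i≢j : i ≢ j
    i≢j = F.<⇒≢ i<j

    i→j : G i j ≡ true
    i→j = proj₁ (proj₂ rot)

    j→i : G' j i ≡ true
    j→i = proj₁ (proj₂ (proj₂ rot))

    keep : PreservesCuts G G' i j
    keep = proj₁ (proj₂ (proj₂ (proj₂ rot)))

    keep' : PreservesCuts G' G j i
    keep' a' b' a'→b' ≢ji with proj₂ (proj₂ (proj₂ (proj₂ rot))) a' b' a'→b' ≢ji
    ... | a , b , a→b , same = a , b , a→b , λ w → sym (same w)

    module Forward  = CutTransport (IsPermutree.tree P) (IsPermutree.tree P')
    module Backward = CutTransport (IsPermutree.tree P') (IsPermutree.tree P)

  descendants-elsewhere : ∀ k → k ≢ i → k ≢ j → ∀ w → inD G k w ≡ inD G' k w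
  descendants-elsewhere k k≢i k≢j w = ⇔-true⇒≡ forward backward
    where
    forward : inD G k w ≡ true → inD G' k w ≡ true
    forward kw with Forward.inD-transport keep keep' k≢j kw
    ... | inj₁ kw'                      = kw'
    ... | inj₂ (_ , inj₁ (_ , k≡i) , _) = ⊥-elim (k≢i k≡i)
    ... | inj₂ (_ , inj₂ (_ , k≡j) , _) = ⊥-elim (k≢j k≡j)
    backward : inD G' k w ≡ true → inD G k w ≡ true
    backward kw with Backward.inD-transport keep' keep k≢i kw
    ... | inj₁ kw'                      = kw'
    ... | inj₂ (_ , inj₁ (_ , k≡j) , _) = ⊥-elim (k≢j k≡j)
    ... | inj₂ (_ , inj₂ (_ , k≡i) , _) = ⊥-elim (k≢i k≡i)

  descendants-i-grow : ∀ w → inD G i w ≡ true → inD G' i w ≡ true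
  descendants-i-grow w iw with Forward.inD-transport keep keep' i≢j iw
  ... | inj₁ iw'                          = iw'
  ... | inj₂ (_ , inj₁ (refl , _) , jw)   = inD⁺ G' j→i jw
  ... | inj₂ (_ , inj₂ (_ , i≡j) , _)     = ⊥-elim (i≢j i≡j)

  j-notBelow-i : inD G i j ≡ false
  j-notBelow-i with inD G i j in ij
  ... | false = refl
  ... | true with inD⁻ G ij
  ...   | c , c→i , cj with Old.cutSide-crossing (edge⇒adj G c→i) (Old.comp⇒cutSide cj)
                                                 (Old.cutSide-target (edge⇒adj G c→i)) (edge⇒adj˘ G i→j)
  ...     | refl , _ = ⊥-elim (not-¬ c→i (Old.edge-asym i→j))

  j-below-i' : inD G' i j ≡ true
  j-below-i' = inD⁺ G' j→i (New.comp-refl i j)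

  descendants-j-shrink : ∀ w → inD G' j w ≡ true → inD G j w ≡ true
  descendants-j-shrink w jw with Backward.inD-transport keep' keep (λ j≡i → i≢j (sym j≡i)) jw
  ... | inj₁ jw'                          = jw'
  ... | inj₂ (_ , inj₁ (refl , _) , iw)   = inD⁺ G i→j iw
  ... | inj₂ (_ , inj₂ (_ , j≡i) , _)     = ⊥-elim (i≢j (sym j≡i))

  private
    ij : adj G i j ≡ true
    ij = edge⇒adj G i→j

    ij' : adj G' i j ≡ true
    ij' = edge⇒adj˘ G' j→i

    -- above-i is conditional: the sides of the children of i in T are only constrained when δ i
    -- allows two children.
    record EdgeTowards (w : Fin n) : Set where
      field
        e k      : Fin n
        e→k      : G e k ≡ true
        e≢i      : e ≢ i
        e≢j      : e ≢ j
        k∈ij     : k ≡ i ⊎ k ≡ j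
        w-below  : comp G k e w ≡ true
        above-i  : twoChildren (δ i) ≡ true → ∀ v → comp G k e v ≡ true → i F.< v

    secondParent-below : ∀ {x w} → G i x ≡ true → x ≢ j → comp G i x w ≡ true → ¬ (i F.< w)
    secondParent-below {x} {w} i→x x≢j xw i<w = sides (IsPermutree.upSides P i twoP x i→x)
      where
      j≢x : j ≢ x
      j≢x j≡x = x≢j (sym j≡x)
      twoP : twoParents (δ i) ≡ true
      twoP = PermutreeProperties.twoParents-of P i→j i→x j≢x
      sides : AllBelow G i x ⊎ AllAbove G i x → ⊥
      sides (inj₁ below) = F.<-asym (below w xw) i<w
      sides (inj₂ above) =
        proj₂ (IsPermutree.upDistinct P i twoP j x i→j i→x j≢x) (i<j , above x (Old.comp-refl i x))

    edgeTowards-sibling : ∀ {c w} → G c j ≡ true → c ≢ i → comp G j c w ≡ true → EdgeTowards w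
    edgeTowards-sibling {c} {w} c→j c≢i cw = record
      { e→k = c→j ; e≢i = c≢i ; e≢j = Old.adj-irrefl (edge⇒adj G c→j) ; k∈ij = inj₂ refl
      ; w-below = cw ; above-i = λ _ → sides (IsPermutree.downSides P j twoC c c→j) }
      where
      twoC : twoChildren (δ j) ≡ true
      twoC = PermutreeProperties.twoChildren-of P c→j i→j c≢i
      sides : AllBelow G j c ⊎ AllAbove G j c → ∀ v → comp G j c v ≡ true → i F.< v
      sides (inj₁ below) = ⊥-elim (proj₁ (IsPermutree.downDistinct P j twoC i c i→j c→j (λ i≡c → c≢i (sym i≡c)))
                                         (i<j , below c (Old.comp-refl j c)))
      sides (inj₂ above) v cv = F.<-trans i<j (above v cv)

    edgeTowards-throughI : ∀ {w} → i F.< w → comp G j i w ≡ true → EdgeTowards w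
    edgeTowards-throughI {w} i<w iw with Old.lastNeighbour i w (λ w≡i → F.<⇒≢ i<w (sym w≡i))
    ... | x , ix , xw = fromNeighbour (∨-true⁻ {G i x} ix)
      where
      x≢j : x ≢ j
      x≢j refl = Old.comp-disjoint ij xw iw
      sides : AllBelow G i x ⊎ AllAbove G i x → ∀ v → comp G i x v ≡ true → i F.< v
      sides (inj₁ below) = ⊥-elim (F.<-asym (below w xw) i<w)
      sides (inj₂ above) = above
      fromNeighbour : G i x ≡ true ⊎ G x i ≡ true → EdgeTowards w
      fromNeighbour (inj₁ i→x) = ⊥-elim (secondParent-below i→x x≢j xw i<w)
      fromNeighbour (inj₂ x→i) = record
        { e→k = x→i ; e≢i = Old.adj-irrefl (edge⇒adj G x→i) ; e≢j = x≢j ; k∈ij = inj₁ refl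
        ; w-below = xw ; above-i = λ twoC → sides (IsPermutree.downSides P i twoC x x→i) }

    edgeTowards : ∀ w → j F.< w → inD G j w ≡ true → EdgeTowards w
    edgeTowards w j<w jw with inD⁻ G jw
    ... | c , c→j , cw with c F.≟ i
    ...   | no  c≢i  = edgeTowards-sibling c→j c≢i cw
    ...   | yes refl = edgeTowards-throughI (F.<-trans i<j j<w) cw

    keptThrough : ∀ {w d} → EdgeTowards w → d ≢ i → adj G' d j ≡ true → comp G' j d w ≡ true → G' d j ≡ true
    keptThrough E d≢i dj dw = proj₁ (Forward.matchingEdge keep keep' e→k (λ r → e≢i (proj₁ r)) w-below dj
      (λ r → i≢j (sym (proj₂ r))) (λ r → d≢i (proj₁ r)) dw
      (Old.cutSide-adjacentEdge ij (edge⇒adj G e→k) e≢i e≢j k∈ij (inj₂ refl))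
      (New.cutSide-adjacentEdge ij' dj d≢i (New.adj-irrefl dj) (inj₂ refl) k∈ij))
      where open EdgeTowards E

    -- reaching w through i in T' would make w's branch a second child of i above i, next to j
    notBeyond-i : ∀ {w} → i F.< w → EdgeTowards w → comp G' j i w ≡ true → ⊥
    notBeyond-i {w} i<w E iw with New.lastNeighbour i w (λ w≡i → F.<⇒≢ i<w (sym w≡i))
    ... | g , ig , gw =
      proj₂ (IsPermutree.downDistinct P' i twoC j g j→i g→i j≢g) (i<j , above-i twoC g (proj₂ matched))
      where
      open EdgeTowards E
      g≢j : g ≢ j
      g≢j refl = New.comp-disjoint ij' gw iw
      j≢g : j ≢ g
      j≢g j≡g = g≢j (sym j≡g)
      g≢i : g ≢ i
      g≢i g≡i = New.adj-irrefl ig (sym g≡i)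
      matched : G' g i ≡ true × comp G k e g ≡ true
      matched = Forward.matchingEdge keep keep' e→k (λ r → e≢i (proj₁ r)) w-below (adj-sym G' ig)
        (λ r → g≢j (proj₁ r)) (λ r → g≢i (proj₁ r)) gw
        (Old.cutSide-adjacentEdge ij (edge⇒adj G e→k) e≢i e≢j k∈ij (inj₁ refl))
        (New.cutSide-adjacentEdge ij' (adj-sym G' ig) g≢i g≢j (inj₁ refl) k∈ij)
      g→i : G' g i ≡ true
      g→i = proj₁ matched
      twoC : twoChildren (δ i) ≡ true
      twoC = PermutreeProperties.twoChildren-of P' j→i g→i j≢g

  descendants-j-aboveKept : ∀ w → j F.< w → inD G j w ≡ true → inD G' j w ≡ true
  descendants-j-aboveKept w j<w jw with New.lastNeighbour j w (λ w≡j → F.<⇒≢ j<w (sym w≡j))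
  ... | d , jd , dw with d F.≟ i
  ...   | no  d≢i  = inD⁺ G' (keptThrough (edgeTowards w j<w jw) d≢i (adj-sym G' jd) dw) dw
  ...   | yes refl = ⊥-elim (notBeyond-i (F.<-trans i<j j<w) (edgeTowards w j<w jw) dw)

  descendantsAbove-unchanged : ∀ k → k ≢ i → ∀ w → k F.< w → inD G k w ≡ inD G' k w
  descendantsAbove-unchanged k k≢i w k<w with k F.≟ j
  ... | no  k≢j  = descendants-elsewhere k k≢i k≢j w
  ... | yes refl = ⇔-true⇒≡ (descendants-j-aboveKept w k<w) (descendants-j-shrink w)

  cubicComponent-unchanged : ∀ k → k ≢ i → cubicComponent T k ≡ cubicComponent T' k
  cubicComponent-unchanged k k≢i = cubicComponent-cong T T' k (descendantsAbove-unchanged k k≢i)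

  cubicComponent-grows : cubicComponent T i ℕ.< cubicComponent T' i
  cubicComponent-grows = cubicComponent-< T T' i descendants-i-grow i<j j-notBelow-i j-below-i'

-- Cubic vectors

IncreasesOnlyAt : ∀ {m} → Vec ℕ m → Vec ℕ m → Fin m → Set
IncreasesOnlyAt xs ys k = lookup xs k ℕ.< lookup ys k × (∀ l → l ≢ k → lookup xs l ≡ lookup ys l)

increasesOnlyAt⇒<lex : ∀ {m} {xs ys : Vec ℕ m} {k} → IncreasesOnlyAt xs ys k → xs <lex ys
increasesOnlyAt⇒<lex {xs = _ ∷ _} {_ ∷ _} {fzero}   (x<y , _)      = this x<y refl
increasesOnlyAt⇒<lex {xs = _ ∷ _} {_ ∷ _} {F.suc k} (grows , same) =
  next (same fzero (λ ())) (increasesOnlyAt⇒<lex (grows , λ l l≢k → same (F.suc l) (l≢k ∘ F.suc-injective)))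

<lex-trans : ∀ {m} {xs ys zs : Vec ℕ m} → xs <lex ys → ys <lex zs → xs <lex zs
<lex-trans = IsStrictPartialOrder.trans (Lex.<-isStrictPartialOrder ℕ.<-isStrictPartialOrder)

module _ {m : ℕ} {δ : Fin (suc m) → Decoration} where

  cubicVector-lookup : (T : Permutree δ) (k : Fin m) → lookup (cubicVector T) k ≡ cubicComponent T (F.inject₁ k)
  cubicVector-lookup T = lookup∘tabulate _

  rotation-increasesOnlyAt : (T T' : Permutree δ) → IncreasingRotation T T' →
                             ∃[ k ] IncreasesOnlyAt (cubicVector T) (cubicVector T') k
  rotation-increasesOnlyAt T T' (i , j , rot) = k , grows , same
    where
    open RotationProperties T T' i j rot
    i≢last : m ≢ F.toℕ i
    i≢last m≡i = ℕ.<-irrefl (sym m≡i) (ℕ.<-≤-trans (proj₁ rot) (ℕ.≤-pred (F.toℕ<n j)))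
    k : Fin m
    k = F.lower₁ i i≢last
    k≡i : F.inject₁ k ≡ i
    k≡i = F.inject₁-lower₁ i i≢last
    grows : lookup (cubicVector T) k ℕ.< lookup (cubicVector T') k
    grows rewrite cubicVector-lookup T k | cubicVector-lookup T' k | k≡i = cubicComponent-grows
    same : ∀ l → l ≢ k → lookup (cubicVector T) l ≡ lookup (cubicVector T') l
    same l l≢k rewrite cubicVector-lookup T l | cubicVector-lookup T' l =
      cubicComponent-unchanged (F.inject₁ l) (λ l≡i → l≢k (F.inject₁-injective (trans l≡i (sym k≡i))))

  rotation⇒<lex : (T T' : Permutree δ) → IncreasingRotation T T' → cubicVector T <lex cubicVector T'
  rotation⇒<lex T T' rot = increasesOnlyAt⇒<lex (proj₂ (rotation-increasesOnlyAt T T' rot))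

  rotation⁺⇒<lex : (T T' : Permutree δ) → T <rot T' → cubicVector T <lex cubicVector T'
  rotation⁺⇒<lex T T' [ rot ] = rotation⇒<lex T T' rot
  rotation⁺⇒<lex T T' (_∷_ {y = S} rot rots) = <lex-trans (rotation⇒<lex T S rot) (rotation⁺⇒<lex S T' rots)

  cover⇒rotation : ∀ {T T' : Permutree δ} → T ⋖ T' → IncreasingRotation T T'
  cover⇒rotation ([ rot ] , _)              = rot
  cover⇒rotation ((rot ∷ rots) , noneBetween) = ⊥-elim (noneBetween (_ , [ rot ] , rots))

theorem3p5 : (m : ℕ) (δ : Fin (suc m) → Decoration) →
    δ fzero ≡ none → δ (fromℕ m) ≡ none →
    ((T T' : Permutree δ) → T <rot T' → cubicVector T <lex cubicVector T') ×
    ((T T' : Permutree δ) → T ⋖ T' →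
      ∃[ i ] (lookup (cubicVector T) i ≢ lookup (cubicVector T') i ×
              (∀ k → k ≢ i → lookup (cubicVector T) k ≡ lookup (cubicVector T') k)))
theorem3p5 m δ _ _ = rotation⁺⇒<lex , coverStep
  where
  coverStep : (T T' : Permutree δ) → T ⋖ T' →
              ∃[ i ] (lookup (cubicVector T) i ≢ lookup (cubicVector T') i ×
                      (∀ k → k ≢ i → lookup (cubicVector T) k ≡ lookup (cubicVector T') k))
  coverStep T T' cover with rotation-increasesOnlyAt T T' (cover⇒rotation cover)
  ... | k , grows , same = k , ℕ.<⇒≢ grows , same
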